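{- Let $d\in\mathbb{N}$, $\lambda\in\mathbb{K}^{d+1}$, $\overline{D_E}=\mathrm{Vect}(\mathbb{N}^{d+1}\sqcup\{\Xi\})$, $\overline{D_V}=\mathrm{Vect}(\mathbb{N}^{d+1}\sqcup\{\star\})$, and let $\overline{\phi}^\lambda$ be the endomorphism of $\overline{D_E}\otimes\overline{D_V}$ given, for $a,b\in\mathbb{N}^{d+1}$, by $\overline{\phi}^\lambda(a\otimes b)=\sum_{l\leq\min(a,b)}\lambda^l\binom{b}{l}(a-l)\otimes(b-l)$, $\overline{\phi}^\lambda(a\otimes\star)=0$, $\overline{\phi}^\lambda(\Xi\otimes b)=\Xi\otimes b$, $\overline{\phi}^\lambda(\Xi\otimes\star)=0$. Consider the pre-Lie algebra $\overline{D_E}\otimes\mathcal{T}(\overline{D_E},\overline{D_V})$ with product $(a\otimes x)\triangleleft(a'\otimes x')=a'\otimes(x\triangleleft^{\overline{\phi}^\lambda}_a x')$, and let $\mathfrak{g}$ be its pre-Lie subalgebra generated by the planted trees $\Xi\otimes\bullet_\star$, $a\otimes\bullet_\star$ and $a\otimes\bullet_b$ for $a,b\in\mathbb{N}^{d+1}$ (where $\bullet_c$ is the one-vertex tree decorated by $c$). Then $\mathfrak{g}$ is spanned by the $\Xi$-admissible tensors, namely the elements $a\otimes T\otimes W_T$ with $a\in\mathbb{N}^{d+1}\sqcup\{\Xi\}$, $T\otimes W_T$ a tree whose vertices are decorated by elements of $\mathbb{N}^{d+1}\sqcup\{\star\}$ and edges by elements of $\mathbb{N}^{d+1}\sqcup\{\Xi\}$,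 such that: if $a=\Xi$ then $T$ is the single vertex decorated $\star$; every edge $e$ decorated by $\Xi$ has its target $t(e)$ decorated by $\star$; every vertex decorated by $\star$ is a leaf of $T$.
   Context: $\mathbb{K}$ is a field of characteristic zero. On $\mathbb{N}^{d+1}$, $l\leq b$ and $\min$ are componentwise, $\binom{b}{l}=\prod_i\binom{b_i}{l_i}$, $\lambda^l=\prod_i\lambda_i^{l_i}$ ($0^0=1$). For vector spaces $D_E,D_V$: rooted trees are finite non-planar, edges oriented from root to leaves with source $s(e)$ (endpoint nearer the root) and target $t(e)$; $\mathcal{T}(D_E,D_V)=\bigoplus_T\bigl(\bigotimes_{e\in E(T)}D_E\otimes\bigotimes_{v\in V(T)}D_V\bigr)$, elements $T\otimes W_T$ with $W_T$ the tensor of edge and vertex decorations. For $v\in V(T')$, $T\curvearrowright_vT'$ adds an edge from $v$ to the root of $T$; for a linear $\phi$ on $D_E\otimes D_V$, $(T\otimes W_T)\triangleleft^\phi_a(T'\otimes W_{T'})=\sum_{v\in V(T')}T\curvearrowright_vT'\otimes\phi_{e_{\mathrm{new}},v}(a\otimes W_T\otimes W_{T'})$, where $a$ decorates the new edge and $\phi_{e,v}$ applies $\phi$ to the decorations of $e$ and $v$. An element $a\otimes x$ is viewed as a planted tree: $x$ with an extra undecorated root joined to its root by an edge decorated $a$. A leaf is a vertex with no outgoing edge. -}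

module Defs where

open import Level using (Level; _⊔_) renaming (suc to lsuc)
open import Algebra.Bundles using (CommutativeRing)
open import Data.Nat as ℕ using (ℕ; zero; suc)
open import Data.Nat.Combinatorics using (_C_)
open import Data.Bool using (Bool; true; false; if_then_else_)
open import Data.List using (List; []; _∷_; _++_; map; concat; concatMap; length; foldr; filter)
open import Data.List.Properties using (≡-dec)
open import Data.Vec as Vec using (Vec; []; _∷_; toList)
open import Data.Product using (Σ; _×_; _,_; proj₁; proj₂)
open import Relation.Binary.PropositionalEquality using (_≡_)
open import Relation.Nullary using (¬_; Dec; yes; no)
open import Relation.Nullary.Decidable using (⌊_⌋)
open import Function.Bundles using (_⇔_)

module _ {c ℓ : Level} (R : CommutativeRing c ℓ) where
  open CommutativeRing R

  ℕ→K : ℕ → Carrier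
  ℕ→K zero = 0#
  ℕ→K (suc n) = 1# + ℕ→K n

  IsField : Set (c ⊔ ℓ)
  IsField = (¬ (1# ≈ 0#)) × (∀ x → ¬ (x ≈ 0#) → Σ Carrier λ y → (x * y) ≈ 1#)

  CharZero : Set ℓ
  CharZero = ∀ n → ¬ (ℕ→K (suc n) ≈ 0#)

module Decorations (d : ℕ) where

  Tup : Set
  Tup = Vec ℕ (suc d)

  data EB : Set where
    xi : EB
    nE : Tup → EB

  data VB : Set where
    star : VB
    nV   : Tup → VB

  -- planar representatives of rooted trees : a root decoration and a
  -- list of (edge decoration , subtree) for the outgoing edges
  data Tree : Set where
    node : VB → List (EB × Tree) → Tree

  root : Tree → VB
  root (node v _) = v

  PT : Set
  PT = EB × Tree

  _≤?t_ : ∀ {n} → Vec ℕ n → Vec ℕ n → Bool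
  [] ≤?t [] = true
  (x ∷ xs) ≤?t (y ∷ ys) = if ⌊ x ℕ.≤? y ⌋ then xs ≤?t ys else false

  below : ∀ {n} → Vec ℕ n → List (Vec ℕ n)
  below [] = [] ∷ []
  below (a ∷ as) = concatMap (λ i → map (i ∷_) (below as)) (Data.List.upTo (suc a))

  _-t_ : ∀ {n} → Vec ℕ n → Vec ℕ n → Vec ℕ n
  a -t l = Vec.zipWith ℕ._∸_ a l

  binomT : ∀ {n} → Vec ℕ n → Vec ℕ n → ℕ
  binomT b l = Vec.foldr _ ℕ._*_ 1 (Vec.zipWith _C_ b l)

  -- Canonical codes of trees up to isomorphism (non-planar trees):
  -- children codes are sorted lexicographically; the encoding is
  -- prefix-free since tuples have the fixed length d+1.

  lexLeq : List ℕ → List ℕ → Bool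
  lexLeq [] _ = true
  lexLeq (_ ∷ _) [] = false
  lexLeq (x ∷ xs) (y ∷ ys) =
    if ⌊ x ℕ.<? y ⌋ then true else (if ⌊ x ℕ.≟ y ⌋ then lexLeq xs ys else false)

  insert : List ℕ → List (List ℕ) → List (List ℕ)
  insert x [] = x ∷ []
  insert x (y ∷ ys) = if lexLeq x y then x ∷ y ∷ ys else y ∷ insert x ys

  isort : List (List ℕ) → List (List ℕ)
  isort = foldr insert []

  codeE : EB → List ℕ
  codeE xi = 0 ∷ []
  codeE (nE a) = 1 ∷ toList a

  codeV : VB → List ℕ
  codeV star = 0 ∷ []
  codeV (nV b) = 1 ∷ toList b

  code : Tree → List ℕ
  codeCh : List (EB × Tree) → List (List ℕ)
  code (node v cs) = codeV v ++ (length cs ∷ concat (isort (codeCh cs)))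
  codeCh [] = []
  codeCh ((e , t) ∷ cs) = (codeE e ++ code t) ∷ codeCh cs

  codeP : PT → List ℕ
  codeP (a , t) = codeE a ++ code t

  data AdmT : Tree → Set
  data AdmCh : List (EB × Tree) → Set
  data AdmT where
    adm : ∀ {v cs} → (v ≡ star → cs ≡ []) → AdmCh cs → AdmT (node v cs)
  data AdmCh where
    []  : AdmCh []
    _∷_ : ∀ {e t cs} → ((e ≡ xi → root t ≡ star) × AdmT t) → AdmCh cs →
          AdmCh ((e , t) ∷ cs)

  Admissible : PT → Set
  Admissible (a , t) = (a ≡ xi → t ≡ node star []) × AdmT t

  data Generator : PT → Set where
    gXi   : Generator (xi , node star [])
    gStar : ∀ a → Generator (nE a , node star [])
    gVert : ∀ a b → Generator (nE a , node (nV b) [])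

module Construction {c ℓ : Level} (R : CommutativeRing c ℓ) (d : ℕ)
                    (lam : Vec (CommutativeRing.Carrier R) (suc d)) where
  open CommutativeRing R
  open Decorations d public

  -- formal linear combinations of planted trees; equality below is
  -- equality in the free vector space on isomorphism classes
  Vect : Set c
  Vect = List (Carrier × PT)

  coeff : List ℕ → Vect → Carrier
  coeff k [] = 0#
  coeff k ((x , p) ∷ v) with ≡-dec ℕ._≟_ (codeP p) k
  ... | yes _ = x + coeff k v
  ... | no  _ = coeff k v

  _≈V_ : Vect → Vect → Set ℓ
  u ≈V w = ∀ k → coeff k u ≈ coeff k w

  scaleV : Carrier → Vect → Vect
  scaleV x = map (λ { (y , p) → (x * y , p) })

  pow : Carrier → ℕ → Carrier
  pow x zero = 1#
  pow x (suc n) = x * pow x n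

  lamPow : Tup → Carrier
  lamPow l = Vec.foldr _ _*_ 1# (Vec.zipWith pow lam l)

  phi : EB → VB → List (Carrier × (EB × VB))
  phi (nE a) (nV b) =
    map (λ l → (lamPow l * ℕ→K R (binomT b l) , (nE (a -t l) , nV (b -t l))))
        (filter (λ l → Dec-from-Bool (l ≤?t b)) (below a))
    where
      Dec-from-Bool : (x : Bool) → Dec (x ≡ true)
      Dec-from-Bool true = yes _≡_.refl
      Dec-from-Bool false = no (λ ())
  phi (nE a) star = []
  phi xi (nV b) = (1# , (xi , nV b)) ∷ []
  phi xi star = []

  -- x ◁^φ_a x' on basis trees : sum over vertices v of x' of grafting x
  -- onto v with a new edge decorated a, then φ applied at (new edge , v)
  graft : EB → Tree → Tree → List (Carrier × Tree)
  graftCh : EB → Tree → List (EB × Tree) → List (Carrier × List (EB × Tree))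
  graft a x (node v cs) =
    map (λ { (k , (e' , v')) → (k , node v' ((e' , x) ∷ cs)) }) (phi a v)
    ++ map (λ { (k , cs') → (k , node v cs') }) (graftCh a x cs)
  graftCh a x [] = []
  graftCh a x ((e , t) ∷ cs) =
    map (λ { (k , t') → (k , (e , t') ∷ cs) }) (graft a x t)
    ++ map (λ { (k , cs') → (k , (e , t) ∷ cs') }) (graftCh a x cs)

  _◁_ : Vect → Vect → Vect
  u ◁ w = concatMap (λ { (y , (a , x)) →
            concatMap (λ { (y' , (a' , x')) →
              map (λ { (k , t) → (y * y' * k , (a' , t)) }) (graft a x x') }) w }) u

  data InG : Vect → Set (c ⊔ ℓ) where
    gen   : ∀ {p} → Generator p → InG ((1# , p) ∷ [])
    zeroG : InG []
    addG  : ∀ {u w} → InG u → InG w → InG (u ++ w)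
    scalG : ∀ {u} x → InG u → InG (scaleV x u)
    prodG : ∀ {u w} → InG u → InG w → InG (u ◁ w)
    respG : ∀ {u w} → u ≈V w → InG u → InG w

  InSpan : Vect → Set (c ⊔ ℓ)
  InSpan v = Σ Vect λ L → All (λ q → Admissible (proj₂ q)) L × (v ≈V L)
    where open import Data.List.Relation.Unary.All using (All)

module Submission where

-- The product of planted trees is computed on planar representatives, but its coefficients only
-- depend on the isomorphism classes of the factors: grafting respects the canonical codes of the
-- grafted tree and, up to a permutation of its terms, isomorphisms of the tree grafted onto. So
-- the product is bilinear for equality of coefficients, and since neither grafting nor φ-bar
-- creates a Ξ-edge into a non-⋆ vertex or a ⋆-vertex with children, the span of the Ξ-admissible
-- tensors is a pre-Lie subalgebra containing the generators.
--
-- Conversely, let a ⊗ T be admissible, where the root b of T has a child S₁ along an edge e₁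
-- besides the children rest. Then (e₁ ⊗ S₁) ◁ (a ⊗ node b rest) is a ⊗ T (the summand l = 0 of
-- φ-bar(e₁ ⊗ b), grafted at the root) plus admissible terms with as many vertices as T and a
-- smaller rank, the total degree of the decorations of T plus the number of children of its root:
-- the other summands of φ-bar lower the degree, and grafting further up leaves the root with one
-- child less. Both factors have fewer vertices than T, so induction on (vertices, rank) shows
-- that every admissible planted tree lies in 𝔤.

open import Defs
open import Level using (Level)
open import Algebra.Bundles using (CommutativeRing)
import Algebra.Properties.CommutativeSemigroup as CommutativeSemigroupProperties
import Algebra.Properties.Group as GroupProperties
import Algebra.Properties.Ring as RingProperties
open import Data.Bool using (true; false)
open import Data.Empty using (⊥; ⊥-elim)
open import Data.Nat as ℕ using (ℕ; suc; _≤_; _<_; z≤n; s≤s)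
open import Data.Nat.Induction using (<-wellFounded)
import Data.Nat.Properties as ℕₚ
open import Data.Nat.Tactic.RingSolver using (solve-∀)
open import Data.List using (List; []; _∷_; _++_; map; concat; concatMap; length; applyUpTo; filter)
import Data.List.Properties as Listₚ
open import Data.List.Relation.Unary.All as All using (All; []; _∷_)
import Data.List.Relation.Unary.All.Properties as Allₚ
open import Data.List.Relation.Binary.Permutation.Propositional as ↭
  using (_↭_; ↭-sym; ↭-trans; module PermutationReasoning)
import Data.List.Relation.Binary.Permutation.Propositional.Properties as ↭ₚ
open import Data.Product using (Σ; ∃; _×_; _,_; proj₁; proj₂; map₂)
open import Data.Product.Relation.Binary.Lex.Strict using (×-Lex; ×-wellFounded)
open import Data.Sum using (inj₁; inj₂)
open import Data.Unit using (⊤; tt)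
open import Data.Vec as Vec using (Vec; []; _∷_; toList)
open import Data.Vec.Relation.Binary.Pointwise.Inductive using (Pointwise; []; _∷_)
open import Data.Vec.Relation.Unary.Any using (Any; here; there)
open import Function using (_∘_; _on_)
open import Function.Bundles using (_⇔_; mk⇔)
open import Induction.WellFounded as WF using (WellFounded)
open import Relation.Binary.Definitions using (tri<; tri≈; tri>)
open import Relation.Binary.PropositionalEquality as ≡ using (_≡_; _≢_; cong; cong₂; subst₂)
import Relation.Binary.Construct.On as On
open import Relation.Nullary using (Dec; yes; no)
open import Relation.Unary using (Decidable)

++-exchange : ∀ {a} {A : Set a} (xs ys zs : List A) → xs ++ ys ++ zs ↭ ys ++ xs ++ zs
++-exchange xs ys zs = begin
  xs ++ ys ++ zs   ≡⟨ Listₚ.++-assoc xs ys zs ⟨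
  (xs ++ ys) ++ zs ↭⟨ ↭ₚ.++⁺ʳ zs (↭ₚ.++-comm xs ys) ⟩
  (ys ++ xs) ++ zs ≡⟨ Listₚ.++-assoc ys xs zs ⟩
  ys ++ xs ++ zs   ∎
  where open PermutationReasoning

map-map-cong : ∀ {a b c d} {A : Set a} {B : Set b} {C : Set c} {D : Set d}
  {f : B → D} {g : A → B} {h : C → D} {k : A → C} →
  (∀ z → f (g z) ≡ h (k z)) → ∀ xs → map f (map g xs) ≡ map h (map k xs)
map-map-cong eq []       = ≡.refl
map-map-cong eq (x ∷ xs) = cong₂ _∷_ (eq x) (map-map-cong eq xs)

++-reassoc : ∀ {a} {A : Set a} (xs xs' : List A) {ys ys' zs zs'} →
  (xs ++ ys) ++ zs ≡ (xs' ++ ys') ++ zs' → xs ++ ys ++ zs ≡ xs' ++ ys' ++ zs'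
++-reassoc xs xs' eq = ≡.trans (≡.sym (Listₚ.++-assoc xs _ _)) (≡.trans eq (Listₚ.++-assoc xs' _ _))

true≢false : ∀ {b} → b ≡ true → b ≡ false → ⊥
true≢false ≡.refl ()

module CanonicalCodes (d : ℕ) where
  open Decorations d

  lexLeq-< : ∀ {x y} xs ys → x < y → lexLeq (x ∷ xs) (y ∷ ys) ≡ true
  lexLeq-< {x} {y} xs ys x<y with x ℕ.<? y
  ... | yes _  = ≡.refl
  ... | no x≮y = ⊥-elim (x≮y x<y)

  lexLeq-≡ : ∀ x xs ys → lexLeq (x ∷ xs) (x ∷ ys) ≡ lexLeq xs ys
  lexLeq-≡ x xs ys with x ℕ.<? x | x ℕ.≟ x
  ... | yes x<x | _       = ⊥-elim (ℕₚ.<-irrefl ≡.refl x<x)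
  ... | no _    | yes _   = ≡.refl
  ... | no _    | no x≢x  = ⊥-elim (x≢x ≡.refl)

  lexLeq-> : ∀ {x y} xs ys → y < x → lexLeq (x ∷ xs) (y ∷ ys) ≡ false
  lexLeq-> {x} {y} xs ys y<x with x ℕ.<? y | x ℕ.≟ y
  ... | yes x<y | _      = ⊥-elim (ℕₚ.<-asym y<x x<y)
  ... | no _    | yes x≡y = ⊥-elim (ℕₚ.<-irrefl (≡.sym x≡y) y<x)
  ... | no _    | no _   = ≡.refl

  lexLeq-total : ∀ xs ys → lexLeq xs ys ≡ false → lexLeq ys xs ≡ true
  lexLeq-total []       ys       ()
  lexLeq-total (x ∷ xs) []       _  = ≡.refl
  lexLeq-total (x ∷ xs) (y ∷ ys) xs≰ys with ℕ.<-cmp x y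
  ... | tri< x<y _ _ = ⊥-elim (true≢false (lexLeq-< xs ys x<y) xs≰ys)
  ... | tri≈ _ ≡.refl _ rewrite lexLeq-≡ x xs ys | lexLeq-≡ x ys xs = lexLeq-total xs ys xs≰ys
  ... | tri> _ _ y<x = lexLeq-< ys xs y<x

  lexLeq-antisym : ∀ xs ys → lexLeq xs ys ≡ true → lexLeq ys xs ≡ true → xs ≡ ys
  lexLeq-antisym []       []       _ _ = ≡.refl
  lexLeq-antisym []       (y ∷ ys) _ ()
  lexLeq-antisym (x ∷ xs) []       ()
  lexLeq-antisym (x ∷ xs) (y ∷ ys) xs≤ys ys≤xs with ℕ.<-cmp x y
  ... | tri< x<y _ _ = ⊥-elim (true≢false ys≤xs (lexLeq-> ys xs x<y))
  ... | tri> _ _ y<x = ⊥-elim (true≢false xs≤ys (lexLeq-> xs ys y<x))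
  ... | tri≈ _ ≡.refl _ rewrite lexLeq-≡ x xs ys | lexLeq-≡ x ys xs =
    cong (x ∷_) (lexLeq-antisym xs ys xs≤ys ys≤xs)

  lexLeq-trans : ∀ xs ys zs → lexLeq xs ys ≡ true → lexLeq ys zs ≡ true → lexLeq xs zs ≡ true
  lexLeq-trans []       ys       zs       _ _ = ≡.refl
  lexLeq-trans (x ∷ xs) []       zs       ()
  lexLeq-trans (x ∷ xs) (y ∷ ys) []       _ ()
  lexLeq-trans (x ∷ xs) (y ∷ ys) (z ∷ zs) xs≤ys ys≤zs with ℕ.<-cmp x y | ℕ.<-cmp y z
  ... | tri> _ _ y<x   | _              = ⊥-elim (true≢false xs≤ys (lexLeq-> xs ys y<x))
  ... | _              | tri> _ _ z<y   = ⊥-elim (true≢false ys≤zs (lexLeq-> ys zs z<y))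
  ... | tri< x<y _ _   | tri< y<z _ _   = lexLeq-< xs zs (ℕₚ.<-trans x<y y<z)
  ... | tri< x<y _ _   | tri≈ _ ≡.refl _ = lexLeq-< xs zs x<y
  ... | tri≈ _ ≡.refl _ | tri< y<z _ _   = lexLeq-< xs zs y<z
  ... | tri≈ _ ≡.refl _ | tri≈ _ ≡.refl _
    rewrite lexLeq-≡ x xs ys | lexLeq-≡ x ys zs | lexLeq-≡ x xs zs = lexLeq-trans xs ys zs xs≤ys ys≤zs

  insert-comm : ∀ x y l → insert x (insert y l) ≡ insert y (insert x l)
  insert-comm x y [] with lexLeq x y in x≤y | lexLeq y x in y≤x
  ... | true  | true  rewrite lexLeq-antisym x y x≤y y≤x = ≡.refl
  ... | true  | false = ≡.refl
  ... | false | true  = ≡.refl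
  ... | false | false = ⊥-elim (true≢false (lexLeq-total x y x≤y) y≤x)
  insert-comm x y (z ∷ zs) with lexLeq x z in x≤z | lexLeq y z in y≤z
  ... | true | true with lexLeq x y in x≤y | lexLeq y x in y≤x
  ...   | true  | true  rewrite lexLeq-antisym x y x≤y y≤x = ≡.refl
  ...   | true  | false rewrite y≤z = ≡.refl
  ...   | false | true  rewrite x≤z = ≡.refl
  ...   | false | false = ⊥-elim (true≢false (lexLeq-total x y x≤y) y≤x)
  insert-comm x y (z ∷ zs) | true | false rewrite x≤z with lexLeq y x in y≤x
  ...   | true  = ⊥-elim (true≢false (lexLeq-trans y x z y≤x x≤z) y≤z)
  ...   | false rewrite y≤z = ≡.refl
  insert-comm x y (z ∷ zs) | false | true rewrite y≤z with lexLeq x y in x≤y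
  ...   | true  = ⊥-elim (true≢false (lexLeq-trans x y z x≤y y≤z) x≤z)
  ...   | false rewrite x≤z = ≡.refl
  insert-comm x y (z ∷ zs) | false | false rewrite x≤z | y≤z = cong (z ∷_) (insert-comm x y zs)

  isort-resp-↭ : ∀ {xs ys} → xs ↭ ys → isort xs ≡ isort ys
  isort-resp-↭ ↭.refl                   = ≡.refl
  isort-resp-↭ (↭.prep x p)             = cong (insert x) (isort-resp-↭ p)
  isort-resp-↭ (↭.swap {ys = ys} x y p) =
    ≡.trans (cong (insert x ∘ insert y) (isort-resp-↭ p)) (insert-comm x y (isort ys))
  isort-resp-↭ (↭.trans p q)            = ≡.trans (isort-resp-↭ p) (isort-resp-↭ q)

  insert-↭ : ∀ x l → insert x l ↭ x ∷ l
  insert-↭ x []       = ↭.refl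
  insert-↭ x (y ∷ ys) with lexLeq x y
  ... | true  = ↭.refl
  ... | false = ↭.trans (↭.prep y (insert-↭ x ys)) (↭.swap y x ↭.refl)

  isort-↭ : ∀ l → isort l ↭ l
  isort-↭ []      = ↭.refl
  isort-↭ (x ∷ l) = ↭.trans (insert-↭ x (isort l)) (↭.prep x (isort-↭ l))

  edgeCode : EB × Tree → List ℕ
  edgeCode (e , t) = codeE e ++ code t

  codeCh≡map : ∀ cs → codeCh cs ≡ map edgeCode cs
  codeCh≡map []             = ≡.refl
  codeCh≡map ((e , t) ∷ cs) = cong (_ ∷_) (codeCh≡map cs)

  childCodes : List (EB × Tree) → List (List ℕ)
  childCodes cs = isort (codeCh cs)

  childCodes-resp-↭ : ∀ {cs zs} → cs ↭ zs → childCodes cs ≡ childCodes zs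
  childCodes-resp-↭ {cs} {zs} p = begin
    isort (codeCh cs)       ≡⟨ cong isort (codeCh≡map cs) ⟩
    isort (map edgeCode cs) ≡⟨ isort-resp-↭ (↭ₚ.map⁺ edgeCode p) ⟩
    isort (map edgeCode zs) ≡⟨ cong isort (codeCh≡map zs) ⟨
    isort (codeCh zs)       ∎
    where open ≡.≡-Reasoning

  infix 4 _≅_ _≅ᶜ_
  data _≅_ : Tree → Tree → Set
  data _≅ᶜ_ : List (EB × Tree) → List (EB × Tree) → Set
  data _≅_ where
    ≅-node : ∀ {v cs cs'} zs zs' → cs ↭ zs → zs ≅ᶜ zs' → zs' ↭ cs' → node v cs ≅ node v cs'
  data _≅ᶜ_ where
    []  : [] ≅ᶜ []
    _∷_ : ∀ {e t t' zs zs'} → t ≅ t' → zs ≅ᶜ zs' → (e , t) ∷ zs ≅ᶜ (e , t') ∷ zs'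

  codeNode : VB → List (List ℕ) → List ℕ
  codeNode v s = codeV v ++ (length s ∷ concat s)

  code-node : ∀ v cs → code (node v cs) ≡ codeNode v (childCodes cs)
  code-node v cs = cong (λ n → codeV v ++ (n ∷ concat (childCodes cs)))
    (≡.sym (≡.trans (↭ₚ.↭-length (isort-↭ (codeCh cs))) (codeCh-length cs)))
    where
    codeCh-length : ∀ cs → length (codeCh cs) ≡ length cs
    codeCh-length []       = ≡.refl
    codeCh-length (_ ∷ cs) = cong suc (codeCh-length cs)

  childCodes-resp-≅ : ∀ {v cs cs'} → node v cs ≅ node v cs' → childCodes cs ≡ childCodes cs'
  childCodes-resp-≅ᶜ : ∀ {zs zs'} → zs ≅ᶜ zs' → childCodes zs ≡ childCodes zs'
  edgeCodes-resp-≅ᶜ : ∀ {zs zs'} → zs ≅ᶜ zs' → map edgeCode zs ≡ map edgeCode zs'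

  code-resp-≅ : ∀ {t t'} → t ≅ t' → code t ≡ code t'
  code-resp-≅ {node v cs} {node .v cs'} t≅t'@(≅-node _ _ _ _ _) = begin
    code (node v cs)             ≡⟨ code-node v cs ⟩
    codeNode v (childCodes cs)   ≡⟨ cong (codeNode v) (childCodes-resp-≅ t≅t') ⟩
    codeNode v (childCodes cs')  ≡⟨ code-node v cs' ⟨
    code (node v cs')            ∎
    where open ≡.≡-Reasoning

  childCodes-resp-≅ (≅-node zs zs' p q r) =
    ≡.trans (childCodes-resp-↭ p) (≡.trans (childCodes-resp-≅ᶜ q) (childCodes-resp-↭ r))

  childCodes-resp-≅ᶜ {zs} {zs'} p = begin
    isort (codeCh zs)        ≡⟨ cong isort (codeCh≡map zs) ⟩
    isort (map edgeCode zs)  ≡⟨ cong isort (edgeCodes-resp-≅ᶜ p) ⟩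
    isort (map edgeCode zs') ≡⟨ cong isort (codeCh≡map zs') ⟨
    isort (codeCh zs')       ∎
    where open ≡.≡-Reasoning

  edgeCodes-resp-≅ᶜ []                        = ≡.refl
  edgeCodes-resp-≅ᶜ {(e , _) ∷ _} (t≅t' ∷ p) =
    cong₂ _∷_ (cong (codeE e ++_) (code-resp-≅ t≅t')) (edgeCodes-resp-≅ᶜ p)

  toList-++-injective : ∀ {n} (b b' : Vec ℕ n) r r' → toList b ++ r ≡ toList b' ++ r' → b ≡ b' × r ≡ r'
  toList-++-injective []      []        r r' eq = ≡.refl , eq
  toList-++-injective (x ∷ b) (x' ∷ b') r r' eq with Listₚ.∷-injective eq
  ... | ≡.refl , eq' with toList-++-injective b b' r r' eq'
  ...   | ≡.refl , r≡r' = ≡.refl , r≡r'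

  codeV-++-injective : ∀ v v' r r' → codeV v ++ r ≡ codeV v' ++ r' → v ≡ v' × r ≡ r'
  codeV-++-injective star    star     r r' ≡.refl = ≡.refl , ≡.refl
  codeV-++-injective star    (nV _)   r r' ()
  codeV-++-injective (nV _)  star     r r' ()
  codeV-++-injective (nV b)  (nV b')  r r' eq with toList-++-injective b b' r r' (Listₚ.∷-injectiveʳ eq)
  ... | ≡.refl , r≡r' = ≡.refl , r≡r'

  codeE-++-injective : ∀ e e' r r' → codeE e ++ r ≡ codeE e' ++ r' → e ≡ e' × r ≡ r'
  codeE-++-injective xi      xi       r r' ≡.refl = ≡.refl , ≡.refl
  codeE-++-injective xi      (nE _)   r r' ()
  codeE-++-injective (nE _)  xi       r r' ()
  codeE-++-injective (nE a)  (nE a')  r r' eq with toList-++-injective a a' r r' (Listₚ.∷-injectiveʳ eq)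
  ... | ≡.refl , r≡r' = ≡.refl , r≡r'

  EdgeCodeInjective : EB × Tree → Set
  EdgeCodeInjective (e , t) =
    ∀ e' t' r r' → edgeCode (e , t) ++ r ≡ edgeCode (e' , t') ++ r' → (e ≡ e' × t ≅ t') × r ≡ r'

  edgeCodes-++-injective : ∀ zs zs' r r' → All EdgeCodeInjective zs → length zs ≡ length zs' →
    concat (map edgeCode zs) ++ r ≡ concat (map edgeCode zs') ++ r' → zs ≅ᶜ zs' × r ≡ r'
  edgeCodes-++-injective []       []        r r' _ _  eq = [] , eq
  edgeCodes-++-injective []       (_ ∷ _)   r r' _ ()
  edgeCodes-++-injective (_ ∷ _)  []        r r' _ ()
  edgeCodes-++-injective ((e , t) ∷ zs) ((e' , t') ∷ zs') r r' (inj ∷ injs) len eq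
    with inj e' t' _ _ (++-reassoc (edgeCode (e , t)) (edgeCode (e' , t')) eq)
  ... | (≡.refl , t≅t') , eq' with edgeCodes-++-injective zs zs' r r' injs (ℕₚ.suc-injective len) eq'
  ...   | zs≅zs' , r≡r' = (t≅t' ∷ zs≅zs') , r≡r'

  -- The children of node v cs are parsed in sorted order, a permutation zs of cs; so that the
  -- recursion stays structural, the induction hypothesis is established along cs and transported to zs.
  code-++-injective : ∀ t t' r r' → code t ++ r ≡ code t' ++ r' → t ≅ t' × r ≡ r'
  edgeCode-++-injective : ∀ cs → All EdgeCodeInjective cs

  code-++-injective (node v cs) (node v' cs') r r' eq
    with codeV-++-injective v v' _ _ (++-reassoc (codeV v) (codeV v') eq)
  ... | ≡.refl , eq' with Listₚ.∷-injective eq'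
  ...   | len , eq''
    with ↭ₚ.↭-map-inv edgeCode (↭-sym (isort-↭ (map edgeCode cs)))
       | ↭ₚ.↭-map-inv edgeCode (↭-sym (isort-↭ (map edgeCode cs')))
  ...     | zs , sorted≡zs , cs↭zs | zs' , sorted≡zs' , cs'↭zs' =
    let parsed = edgeCodes-++-injective zs zs' r r'
                   (↭ₚ.All-resp-↭ cs↭zs (edgeCode-++-injective cs))
                   (≡.trans (≡.sym (↭ₚ.↭-length cs↭zs)) (≡.trans len (↭ₚ.↭-length cs'↭zs')))
                   (subst₂ (λ s s' → concat s ++ r ≡ concat s' ++ r')
                      (≡.trans (cong isort (codeCh≡map cs)) sorted≡zs)
                      (≡.trans (cong isort (codeCh≡map cs')) sorted≡zs') eq'')
    in ≅-node zs zs' cs↭zs (proj₁ parsed) (↭-sym cs'↭zs') , proj₂ parsed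

  edgeCode-++-injective []             = []
  edgeCode-++-injective ((e , t) ∷ cs) = inj ∷ edgeCode-++-injective cs
    where
    inj : EdgeCodeInjective (e , t)
    inj e' t' r r' eq
      with codeE-++-injective e e' _ _ (++-reassoc (codeE e) (codeE e') eq)
    ... | ≡.refl , eq' with code-++-injective t t' r r' eq'
    ...   | t≅t' , r≡r' = (≡.refl , t≅t') , r≡r'

  code-injective : ∀ t t' → code t ≡ code t' → t ≅ t'
  code-injective t t' eq =
    proj₁ (code-++-injective t t' [] [] (≡.trans (Listₚ.++-identityʳ (code t))
                                          (≡.trans eq (≡.sym (Listₚ.++-identityʳ (code t'))))))

module GraftInvariance {c ℓ : Level} (R : CommutativeRing c ℓ) (d : ℕ)
                       (lam : Vec (CommutativeRing.Carrier R) (suc d)) where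
  open Construction R d lam
  open CanonicalCodes d
  open CommutativeRing R using (Carrier)

  graftᶜ : EB → Tree → Tree → List (Carrier × List ℕ)
  graftᶜ a x t = map (map₂ code) (graft a x t)

  graftChᶜ : EB → Tree → List (EB × Tree) → List (Carrier × List (List ℕ))
  graftChᶜ a x cs = map (map₂ childCodes) (graftCh a x cs)

  graftRootᶜ : EB → List ℕ → VB → List (List ℕ) → List (Carrier × List ℕ)
  graftRootᶜ a w v s = map (λ (k , (e' , v')) → k , codeNode v' (insert (codeE e' ++ w) s)) (phi a v)

  graftᶜ-node : ∀ a x v cs → graftᶜ a x (node v cs) ≡
    graftRootᶜ a (code x) v (childCodes cs) ++ map (map₂ (codeNode v)) (graftChᶜ a x cs)
  graftᶜ-node a x v cs =
    ≡.trans (Listₚ.map-++ (map₂ code) (map _ (phi a v)) (map _ (graftCh a x cs))) (cong₂ _++_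
      (≡.trans (≡.sym (Listₚ.map-∘ (phi a v)))
        (Listₚ.map-cong (λ (k , (e' , v')) → cong (k ,_) (code-node v' ((e' , x) ∷ cs))) (phi a v)))
      (map-map-cong (λ (k , cs') → cong (k ,_) (code-node v cs')) (graftCh a x cs)))

  graftChᶜ-cons : ∀ a x e t cs → graftChᶜ a x ((e , t) ∷ cs) ≡
    map (map₂ (λ w → insert (codeE e ++ w) (childCodes cs))) (graftᶜ a x t)
    ++ map (map₂ (insert (edgeCode (e , t)))) (graftChᶜ a x cs)
  graftChᶜ-cons a x e t cs =
    ≡.trans (Listₚ.map-++ (map₂ childCodes) (map _ (graft a x t)) (map _ (graftCh a x cs)))
      (cong₂ _++_ (map-map-cong (λ _ → ≡.refl) (graft a x t))
                  (map-map-cong (λ _ → ≡.refl) (graftCh a x cs)))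

  graftᶜ-resp-code : ∀ a {x x'} → code x ≡ code x' → ∀ t → graftᶜ a x t ≡ graftᶜ a x' t
  graftChᶜ-resp-code : ∀ a {x x'} → code x ≡ code x' → ∀ cs → graftChᶜ a x cs ≡ graftChᶜ a x' cs

  graftᶜ-resp-code a {x} {x'} x~x' (node v cs) = begin
    graftᶜ a x (node v cs)
      ≡⟨ graftᶜ-node a x v cs ⟩
    graftRootᶜ a (code x) v (childCodes cs) ++ map (map₂ (codeNode v)) (graftChᶜ a x cs)
      ≡⟨ cong₂ (λ w G → graftRootᶜ a w v (childCodes cs) ++ map (map₂ (codeNode v)) G)
               x~x' (graftChᶜ-resp-code a x~x' cs) ⟩
    graftRootᶜ a (code x') v (childCodes cs) ++ map (map₂ (codeNode v)) (graftChᶜ a x' cs)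
      ≡⟨ graftᶜ-node a x' v cs ⟨
    graftᶜ a x' (node v cs) ∎
    where open ≡.≡-Reasoning

  graftChᶜ-resp-code a x~x' [] = ≡.refl
  graftChᶜ-resp-code a {x} {x'} x~x' ((e , t) ∷ cs) =
    ≡.trans (graftChᶜ-cons a x e t cs) (≡.trans
      (cong₂ (λ G C → map _ G ++ map _ C) (graftᶜ-resp-code a x~x' t) (graftChᶜ-resp-code a x~x' cs))
      (≡.sym (graftChᶜ-cons a x' e t cs)))

  graftChᶜ-cons₂ : ∀ a x e₁ t₁ e₂ t₂ cs → graftChᶜ a x ((e₁ , t₁) ∷ (e₂ , t₂) ∷ cs) ≡
    let w₁ = edgeCode (e₁ , t₁); w₂ = edgeCode (e₂ , t₂); s = childCodes cs in
    map (map₂ (λ w → insert (codeE e₁ ++ w) (insert w₂ s))) (graftᶜ a x t₁)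
    ++ map (map₂ (λ w → insert w₁ (insert (codeE e₂ ++ w) s))) (graftᶜ a x t₂)
    ++ map (map₂ (insert w₁ ∘ insert w₂)) (graftChᶜ a x cs)
  graftChᶜ-cons₂ a x e₁ t₁ e₂ t₂ cs =
    ≡.trans (graftChᶜ-cons a x e₁ t₁ ((e₂ , t₂) ∷ cs)) (cong (map _ (graftᶜ a x t₁) ++_)
      (≡.trans (cong (map _) (graftChᶜ-cons a x e₂ t₂ cs))
        (≡.trans (Listₚ.map-++ _ (map _ (graftᶜ a x t₂)) (map _ (graftChᶜ a x cs)))
          (cong₂ _++_ (≡.sym (Listₚ.map-∘ (graftᶜ a x t₂))) (≡.sym (Listₚ.map-∘ (graftChᶜ a x cs)))))))

  graftChᶜ-resp-↭ : ∀ a x {cs zs} → cs ↭ zs → graftChᶜ a x cs ↭ graftChᶜ a x zs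
  graftChᶜ-resp-↭ a x ↭.refl = ↭.refl
  graftChᶜ-resp-↭ a x (↭.prep {cs} {zs} (e , t) p) = begin
    graftChᶜ a x ((e , t) ∷ cs)
      ≡⟨ graftChᶜ-cons a x e t cs ⟩
    map (map₂ (λ w → insert (codeE e ++ w) (childCodes cs))) (graftᶜ a x t)
      ++ map (map₂ (insert (edgeCode (e , t)))) (graftChᶜ a x cs)
      ≡⟨ cong (λ s → map (map₂ (λ w → insert (codeE e ++ w) s)) (graftᶜ a x t) ++ _)
              (childCodes-resp-↭ p) ⟩
    map (map₂ (λ w → insert (codeE e ++ w) (childCodes zs))) (graftᶜ a x t)
      ++ map (map₂ (insert (edgeCode (e , t)))) (graftChᶜ a x cs)
      ↭⟨ ↭ₚ.++⁺ˡ _ (↭ₚ.map⁺ _ (graftChᶜ-resp-↭ a x p)) ⟩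
    map (map₂ (λ w → insert (codeE e ++ w) (childCodes zs))) (graftᶜ a x t)
      ++ map (map₂ (insert (edgeCode (e , t)))) (graftChᶜ a x zs)
      ≡⟨ graftChᶜ-cons a x e t zs ⟨
    graftChᶜ a x ((e , t) ∷ zs) ∎
    where open PermutationReasoning
  graftChᶜ-resp-↭ a x (↭.swap {cs} {zs} (e₁ , t₁) (e₂ , t₂) p) = begin
    graftChᶜ a x ((e₁ , t₁) ∷ (e₂ , t₂) ∷ cs)
      ≡⟨ graftChᶜ-cons₂ a x e₁ t₁ e₂ t₂ cs ⟩
    map (map₂ (λ w → insert (codeE e₁ ++ w) (insert w₂ s))) G₁
      ++ map (map₂ (λ w → insert w₁ (insert (codeE e₂ ++ w) s))) G₂
      ++ map (map₂ (insert w₁ ∘ insert w₂)) (graftChᶜ a x cs)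
      ↭⟨ ++-exchange (map _ G₁) (map _ G₂) _ ⟩
    map (map₂ (λ w → insert w₁ (insert (codeE e₂ ++ w) s))) G₂
      ++ map (map₂ (λ w → insert (codeE e₁ ++ w) (insert w₂ s))) G₁
      ++ map (map₂ (insert w₁ ∘ insert w₂)) (graftChᶜ a x cs)
      ≡⟨ cong₂ (λ A B → A ++ B ++ map (map₂ (insert w₁ ∘ insert w₂)) (graftChᶜ a x cs))
           (Listₚ.map-cong (λ (k , w) → cong (k ,_) (commute w₁ (codeE e₂ ++ w))) G₂)
           (Listₚ.map-cong (λ (k , w) → cong (k ,_) (commute (codeE e₁ ++ w) w₂)) G₁) ⟩
    map (map₂ (λ w → insert (codeE e₂ ++ w) (insert w₁ s'))) G₂
      ++ map (map₂ (λ w → insert w₂ (insert (codeE e₁ ++ w) s'))) G₁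
      ++ map (map₂ (insert w₁ ∘ insert w₂)) (graftChᶜ a x cs)
      ↭⟨ ↭ₚ.++⁺ˡ (map _ G₂) (↭ₚ.++⁺ˡ (map _ G₁) (begin
           map (map₂ (insert w₁ ∘ insert w₂)) (graftChᶜ a x cs)
             ≡⟨ Listₚ.map-cong (λ (k , s″) → cong (k ,_) (insert-comm w₁ w₂ s″)) (graftChᶜ a x cs) ⟩
           map (map₂ (insert w₂ ∘ insert w₁)) (graftChᶜ a x cs)
             ↭⟨ ↭ₚ.map⁺ _ (graftChᶜ-resp-↭ a x p) ⟩
           map (map₂ (insert w₂ ∘ insert w₁)) (graftChᶜ a x zs) ∎)) ⟩
    map (map₂ (λ w → insert (codeE e₂ ++ w) (insert w₁ s'))) G₂
      ++ map (map₂ (λ w → insert w₂ (insert (codeE e₁ ++ w) s'))) G₁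
      ++ map (map₂ (insert w₂ ∘ insert w₁)) (graftChᶜ a x zs)
      ≡⟨ graftChᶜ-cons₂ a x e₂ t₂ e₁ t₁ zs ⟨
    graftChᶜ a x ((e₂ , t₂) ∷ (e₁ , t₁) ∷ zs) ∎
    where
    open PermutationReasoning
    w₁ = edgeCode (e₁ , t₁)
    w₂ = edgeCode (e₂ , t₂)
    s  = childCodes cs
    s' = childCodes zs
    G₁ = graftᶜ a x t₁
    G₂ = graftᶜ a x t₂
    commute : ∀ u u' → insert u (insert u' s) ≡ insert u' (insert u s')
    commute u u' = ≡.trans (insert-comm u u' s) (cong (insert u' ∘ insert u) (childCodes-resp-↭ p))
  graftChᶜ-resp-↭ a x (↭.trans p q) = ↭-trans (graftChᶜ-resp-↭ a x p) (graftChᶜ-resp-↭ a x q)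

  graftᶜ-resp-≅ : ∀ a x {t t'} → t ≅ t' → graftᶜ a x t ↭ graftᶜ a x t'
  graftChᶜ-resp-≅ᶜ : ∀ a x {zs zs'} → zs ≅ᶜ zs' → graftChᶜ a x zs ↭ graftChᶜ a x zs'

  graftᶜ-resp-≅ a x {node v cs} {node .v cs'} t≅t'@(≅-node zs zs' p q r) = begin
    graftᶜ a x (node v cs)
      ≡⟨ graftᶜ-node a x v cs ⟩
    graftRootᶜ a (code x) v (childCodes cs) ++ map (map₂ (codeNode v)) (graftChᶜ a x cs)
      ≡⟨ cong (λ s → graftRootᶜ a (code x) v s ++ _) (childCodes-resp-≅ t≅t') ⟩
    graftRootᶜ a (code x) v (childCodes cs') ++ map (map₂ (codeNode v)) (graftChᶜ a x cs)
      ↭⟨ ↭ₚ.++⁺ˡ _ (↭ₚ.map⁺ _ (↭-trans (graftChᶜ-resp-↭ a x p)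
                              (↭-trans (graftChᶜ-resp-≅ᶜ a x q) (graftChᶜ-resp-↭ a x r)))) ⟩
    graftRootᶜ a (code x) v (childCodes cs') ++ map (map₂ (codeNode v)) (graftChᶜ a x cs')
      ≡⟨ graftᶜ-node a x v cs' ⟨
    graftᶜ a x (node v cs') ∎
    where open PermutationReasoning

  graftChᶜ-resp-≅ᶜ a x [] = ↭.refl
  graftChᶜ-resp-≅ᶜ a x (_∷_ {e} {t} {t'} {zs} {zs'} t≅t' p) = begin
    graftChᶜ a x ((e , t) ∷ zs)
      ≡⟨ graftChᶜ-cons a x e t zs ⟩
    map (map₂ (λ w → insert (codeE e ++ w) (childCodes zs))) (graftᶜ a x t)
      ++ map (map₂ (insert (edgeCode (e , t)))) (graftChᶜ a x zs)
      ≡⟨ cong₂ (λ s w' → map (map₂ (λ w → insert (codeE e ++ w) s)) (graftᶜ a x t)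
                         ++ map (map₂ (insert (codeE e ++ w'))) (graftChᶜ a x zs))
               (childCodes-resp-≅ᶜ p) (code-resp-≅ t≅t') ⟩
    map (map₂ (λ w → insert (codeE e ++ w) (childCodes zs'))) (graftᶜ a x t)
      ++ map (map₂ (insert (edgeCode (e , t')))) (graftChᶜ a x zs)
      ↭⟨ ↭ₚ.++⁺ (↭ₚ.map⁺ _ (graftᶜ-resp-≅ a x t≅t'))
                 (↭ₚ.map⁺ _ (graftChᶜ-resp-≅ᶜ a x p)) ⟩
    map (map₂ (λ w → insert (codeE e ++ w) (childCodes zs'))) (graftᶜ a x t')
      ++ map (map₂ (insert (edgeCode (e , t')))) (graftChᶜ a x zs')
      ≡⟨ graftChᶜ-cons a x e t' zs' ⟨
    graftChᶜ a x ((e , t') ∷ zs') ∎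
    where open PermutationReasoning

module Coefficients {c ℓ : Level} (R : CommutativeRing c ℓ) (d : ℕ)
                    (lam : Vec (CommutativeRing.Carrier R) (suc d)) where
  open Construction R d lam
  open CanonicalCodes d
  open GraftInvariance R d lam
  open CommutativeRing R
  open import Relation.Binary.Reasoning.Setoid setoid

  _≟ᶜ_ : (w k : List ℕ) → Dec (w ≡ k)
  _≟ᶜ_ = Listₚ.≡-dec ℕ._≟_

  coeffᶜ : List ℕ → List (Carrier × List ℕ) → Carrier
  coeffᶜ k []            = 0#
  coeffᶜ k ((x , w) ∷ v) with w ≟ᶜ k
  ... | yes _ = x + coeffᶜ k v
  ... | no  _ = coeffᶜ k v

  when : ∀ {P : Set} → Dec P → Carrier → Carrier
  when (yes _) x = x
  when (no _)  _ = 0#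

  coeffᶜ-∷ : ∀ k x w v → coeffᶜ k ((x , w) ∷ v) ≈ when (w ≟ᶜ k) x + coeffᶜ k v
  coeffᶜ-∷ k x w v with w ≟ᶜ k
  ... | yes _ = refl
  ... | no  _ = sym (+-identityˡ _)

  coeff-here : ∀ {k} x p v → codeP p ≡ k → coeff k ((x , p) ∷ v) ≡ x + coeff k v
  coeff-here {k} x p v eq with codeP p ≟ᶜ k
  ... | yes _ = ≡.refl
  ... | no ne = ⊥-elim (ne eq)

  coeff-there : ∀ {k} x p v → codeP p ≢ k → coeff k ((x , p) ∷ v) ≡ coeff k v
  coeff-there {k} x p v ne with codeP p ≟ᶜ k
  ... | yes eq = ⊥-elim (ne eq)
  ... | no _   = ≡.refl

  coeff≡coeffᶜ : ∀ k v → coeff k v ≡ coeffᶜ k (map (map₂ codeP) v)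
  coeff≡coeffᶜ k []            = ≡.refl
  coeff≡coeffᶜ k ((x , p) ∷ v) with codeP p ≟ᶜ k
  ... | yes _ = cong (x +_) (coeff≡coeffᶜ k v)
  ... | no  _ = coeff≡coeffᶜ k v

  +-exchange : ∀ x y z → x + (y + z) ≈ y + (x + z)
  +-exchange = CommutativeSemigroupProperties.x∙yz≈y∙xz +-commutativeSemigroup

  coeffᶜ-resp-↭ : ∀ k {xs ys} → xs ↭ ys → coeffᶜ k xs ≈ coeffᶜ k ys
  coeffᶜ-resp-↭ k ↭.refl = refl
  coeffᶜ-resp-↭ k (↭.prep {xs} {ys} (x , w) p) = begin
    coeffᶜ k ((x , w) ∷ xs)       ≈⟨ coeffᶜ-∷ k x w xs ⟩
    when (w ≟ᶜ k) x + coeffᶜ k xs ≈⟨ +-congˡ (coeffᶜ-resp-↭ k p) ⟩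
    when (w ≟ᶜ k) x + coeffᶜ k ys ≈⟨ coeffᶜ-∷ k x w ys ⟨
    coeffᶜ k ((x , w) ∷ ys)       ∎
  coeffᶜ-resp-↭ k (↭.swap {xs} {ys} (x , w) (y , w') p) = begin
    coeffᶜ k ((x , w) ∷ (y , w') ∷ xs)
      ≈⟨ trans (coeffᶜ-∷ k x w _) (+-congˡ (coeffᶜ-∷ k y w' xs)) ⟩
    when (w ≟ᶜ k) x + (when (w' ≟ᶜ k) y + coeffᶜ k xs)
      ≈⟨ +-exchange _ _ _ ⟩
    when (w' ≟ᶜ k) y + (when (w ≟ᶜ k) x + coeffᶜ k xs)
      ≈⟨ +-congˡ (+-congˡ (coeffᶜ-resp-↭ k p)) ⟩
    when (w' ≟ᶜ k) y + (when (w ≟ᶜ k) x + coeffᶜ k ys)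
      ≈⟨ trans (coeffᶜ-∷ k y w' _) (+-congˡ (coeffᶜ-∷ k x w ys)) ⟨
    coeffᶜ k ((y , w') ∷ (x , w) ∷ ys) ∎
  coeffᶜ-resp-↭ k (↭.trans p q) = trans (coeffᶜ-resp-↭ k p) (coeffᶜ-resp-↭ k q)

  coeff-++ : ∀ k u w → coeff k (u ++ w) ≈ coeff k u + coeff k w
  coeff-++ k []            w = sym (+-identityˡ _)
  coeff-++ k ((x , p) ∷ u) w with codeP p ≟ᶜ k
  ... | yes _ = trans (+-congˡ (coeff-++ k u w)) (sym (+-assoc x _ _))
  ... | no  _ = coeff-++ k u w

  coeff-scaleV : ∀ k x u → coeff k (scaleV x u) ≈ x * coeff k u
  coeff-scaleV k x []            = sym (zeroʳ x)
  coeff-scaleV k x ((y , p) ∷ u) with codeP p ≟ᶜ k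
  ... | yes _ = trans (+-congˡ (coeff-scaleV k x u)) (sym (distribˡ x y _))
  ... | no  _ = coeff-scaleV k x u

  ≈V-refl : ∀ u → u ≈V u
  ≈V-refl u k = refl

  ≈V-sym : ∀ u w → u ≈V w → w ≈V u
  ≈V-sym u w u≈w k = sym (u≈w k)

  ≈V-trans : ∀ u v w → u ≈V v → v ≈V w → u ≈V w
  ≈V-trans u v w u≈v v≈w k = trans (u≈v k) (v≈w k)

  ++-cong-≈V : ∀ u u' w w' → u ≈V u' → w ≈V w' → (u ++ w) ≈V (u' ++ w')
  ++-cong-≈V u u' w w' u≈u' w≈w' k = begin
    coeff k (u ++ w)            ≈⟨ coeff-++ k u w ⟩
    coeff k u + coeff k w       ≈⟨ +-cong (u≈u' k) (w≈w' k) ⟩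
    coeff k u' + coeff k w'     ≈⟨ coeff-++ k u' w' ⟨
    coeff k (u' ++ w')          ∎

  scaleV-cong-≈V : ∀ x u u' → u ≈V u' → scaleV x u ≈V scaleV x u'
  scaleV-cong-≈V x u u' u≈u' k = begin
    coeff k (scaleV x u)   ≈⟨ coeff-scaleV k x u ⟩
    x * coeff k u          ≈⟨ *-congˡ (u≈u' k) ⟩
    x * coeff k u'         ≈⟨ coeff-scaleV k x u' ⟨
    coeff k (scaleV x u')  ∎

  coeff-++-scaleV-neg : ∀ k u w → coeff k (u ++ scaleV (- 1#) w) ≈ coeff k u - coeff k w
  coeff-++-scaleV-neg k u w = begin
    coeff k (u ++ scaleV (- 1#) w)        ≈⟨ coeff-++ k u _ ⟩
    coeff k u + coeff k (scaleV (- 1#) w) ≈⟨ +-congˡ (coeff-scaleV k (- 1#) w) ⟩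
    coeff k u + - 1# * coeff k w          ≈⟨ +-congˡ (RingProperties.-1*x≈-x ring _) ⟩
    coeff k u - coeff k w                 ∎

  weightedSum : (PT → Carrier) → Vect → Carrier
  weightedSum g []            = 0#
  weightedSum g ((y , p) ∷ v) = y * g p + weightedSum g v

  weightedSum-++ : ∀ g u w → weightedSum g (u ++ w) ≈ weightedSum g u + weightedSum g w
  weightedSum-++ g []            w = sym (+-identityˡ _)
  weightedSum-++ g ((y , p) ∷ u) w = trans (+-congˡ (weightedSum-++ g u w)) (sym (+-assoc _ _ _))

  weightedSum-scaleV : ∀ g x u → weightedSum g (scaleV x u) ≈ x * weightedSum g u
  weightedSum-scaleV g x []            = sym (zeroʳ x)
  weightedSum-scaleV g x ((y , p) ∷ u) =
    trans (+-cong (*-assoc x y (g p)) (weightedSum-scaleV g x u)) (sym (distribˡ x _ _))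

  weightedSum-cong : ∀ {g g'} → (∀ p → g p ≈ g' p) → ∀ u → weightedSum g u ≈ weightedSum g' u
  weightedSum-cong g≈g' []            = refl
  weightedSum-cong g≈g' ((y , p) ∷ u) = +-cong (*-congˡ (g≈g' p)) (weightedSum-cong g≈g' u)

  removeCode : List ℕ → Vect → Vect
  removeCode k []            = []
  removeCode k ((y , p) ∷ v) with codeP p ≟ᶜ k
  ... | yes _ = removeCode k v
  ... | no  _ = (y , p) ∷ removeCode k v

  coeff-removeCode-≡ : ∀ k v → coeff k (removeCode k v) ≈ 0#
  coeff-removeCode-≡ k []            = refl
  coeff-removeCode-≡ k ((y , q) ∷ v) with codeP q ≟ᶜ k
  ... | yes _ = coeff-removeCode-≡ k v
  ... | no ne = trans (reflexive (coeff-there y q (removeCode k v) ne)) (coeff-removeCode-≡ k v)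

  coeff-removeCode-≢ : ∀ k k' v → k ≢ k' → coeff k (removeCode k' v) ≈ coeff k v
  coeff-removeCode-≢ k k' []            _    = refl
  coeff-removeCode-≢ k k' ((y , q) ∷ v) k≢k' with codeP q ≟ᶜ k' | codeP q ≟ᶜ k
  ... | yes q≡k' | yes q≡k = ⊥-elim (k≢k' (≡.trans (≡.sym q≡k) q≡k'))
  ... | yes _    | no _    = coeff-removeCode-≢ k k' v k≢k'
  ... | no q≢k'  | yes q≡k = trans (reflexive (coeff-here y q (removeCode k' v) q≡k))
                                   (+-congˡ (coeff-removeCode-≢ k k' v k≢k'))
  ... | no q≢k'  | no q≢k  = trans (reflexive (coeff-there y q (removeCode k' v) q≢k))
                                   (coeff-removeCode-≢ k k' v k≢k')

  length-removeCode : ∀ k v → length (removeCode k v) ≤ length v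
  length-removeCode k []            = z≤n
  length-removeCode k ((y , q) ∷ v) with codeP q ≟ᶜ k
  ... | yes _ = ℕₚ.m≤n⇒m≤1+n (length-removeCode k v)
  ... | no  _ = s≤s (length-removeCode k v)

  length-removeCode-here : ∀ k y q v → codeP q ≡ k → length (removeCode k ((y , q) ∷ v)) ≤ length v
  length-removeCode-here k y q v q≡k with codeP q ≟ᶜ k
  ... | yes _  = length-removeCode k v
  ... | no q≢k = ⊥-elim (q≢k q≡k)

  CodeInvariant : (PT → Carrier) → Set ℓ
  CodeInvariant g = ∀ p q → codeP p ≡ codeP q → g p ≈ g q

  weightedSum-removeCode : ∀ {g} → CodeInvariant g → ∀ p v →
    weightedSum g v ≈ g p * coeff (codeP p) v + weightedSum g (removeCode (codeP p) v)
  weightedSum-removeCode g-inv p [] = sym (trans (+-identityʳ _) (zeroʳ _))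
  weightedSum-removeCode {g} g-inv p ((y , q) ∷ v) with codeP q ≟ᶜ codeP p
  ... | yes q~p = begin
    y * g q + weightedSum g v
      ≈⟨ +-cong (*-congˡ (g-inv q p q~p)) (weightedSum-removeCode g-inv p v) ⟩
    y * g p + (g p * coeff (codeP p) v + weightedSum g (removeCode (codeP p) v))
      ≈⟨ +-assoc _ _ _ ⟨
    (y * g p + g p * coeff (codeP p) v) + weightedSum g (removeCode (codeP p) v)
      ≈⟨ +-congʳ (trans (+-congʳ (*-comm y (g p))) (sym (distribˡ (g p) y _))) ⟩
    g p * (y + coeff (codeP p) v) + weightedSum g (removeCode (codeP p) v) ∎
  ... | no _ = trans (+-congˡ (weightedSum-removeCode g-inv p v)) (+-exchange _ _ _)

  weightedSum-≈V[] : ∀ {g} → CodeInvariant g → ∀ v → v ≈V [] → weightedSum g v ≈ 0#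
  weightedSum-≈V[] {g} g-inv v = bounded (length v) v ℕₚ.≤-refl
    where
    bounded : ∀ n v → length v ≤ n → v ≈V [] → weightedSum g v ≈ 0#
    bounded _       []            _       _    = refl
    bounded (suc n) ((y , p) ∷ v) (s≤s l) v≈0 = begin
      weightedSum g ((y , p) ∷ v)
        ≈⟨ weightedSum-removeCode g-inv p ((y , p) ∷ v) ⟩
      g p * coeff (codeP p) ((y , p) ∷ v) + weightedSum g (removeCode (codeP p) ((y , p) ∷ v))
        ≈⟨ +-cong (trans (*-congˡ (v≈0 (codeP p))) (zeroʳ _))
                  (bounded n (removeCode (codeP p) ((y , p) ∷ v))
                     (ℕₚ.≤-trans (length-removeCode-here (codeP p) y p v ≡.refl) l) rest≈0) ⟩
      0# + 0#
        ≈⟨ +-identityˡ _ ⟩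
      0# ∎
      where
      rest≈0 : removeCode (codeP p) ((y , p) ∷ v) ≈V []
      rest≈0 k with k ≟ᶜ codeP p
      ... | yes ≡.refl = coeff-removeCode-≡ k ((y , p) ∷ v)
      ... | no k≢p     = trans (coeff-removeCode-≢ k (codeP p) ((y , p) ∷ v) k≢p) (v≈0 k)

  weightedSum-resp-≈V : ∀ g → CodeInvariant g → ∀ u u' → u ≈V u' →
                        weightedSum g u ≈ weightedSum g u'
  weightedSum-resp-≈V g g-inv u u' u≈u' =
    GroupProperties.x∙y⁻¹≈ε⇒x≈y +-group _ _ (begin
      weightedSum g u + - weightedSum g u'
        ≈⟨ +-congˡ (RingProperties.-1*x≈-x ring _) ⟨
      weightedSum g u + - 1# * weightedSum g u'
        ≈⟨ +-congˡ (weightedSum-scaleV g (- 1#) u') ⟨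
      weightedSum g u + weightedSum g (scaleV (- 1#) u')
        ≈⟨ weightedSum-++ g u _ ⟨
      weightedSum g (u ++ scaleV (- 1#) u')
        ≈⟨ weightedSum-≈V[] g-inv (u ++ scaleV (- 1#) u')
             (λ k → trans (coeff-++-scaleV-neg k u u') (trans (+-congʳ (u≈u' k)) (-‿inverseʳ _))) ⟩
      0# ∎)

  infixl 7 _◁ᵇ_
  _◁ᵇ_ : PT → PT → Vect
  (a , x) ◁ᵇ (a' , x') = map (λ (κ , t) → κ , (a' , t)) (graft a x x')

  coeff-◁ : ∀ k u w →
    coeff k (u ◁ w) ≈ weightedSum (λ p → weightedSum (λ q → coeff k (p ◁ᵇ q)) w) u
  coeff-◁ k []                  w = refl
  coeff-◁ k ((y , (a , x)) ∷ u) w =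
    trans (coeff-++ k (row w) (u ◁ w)) (+-cong (coeff-row w) (coeff-◁ k u w))
    where
    row : Vect → Vect
    row w = concatMap (λ (y' , (a' , x')) → map (λ (κ , t) → (y * y' * κ , (a' , t))) (graft a x x')) w
    coeff-row : ∀ w → coeff k (row w) ≈ y * weightedSum (λ q → coeff k ((a , x) ◁ᵇ q)) w
    coeff-row []                    = sym (zeroʳ y)
    coeff-row ((y' , (a' , x')) ∷ w) = begin
      coeff k (row ((y' , (a' , x')) ∷ w))
        ≡⟨ cong (λ v → coeff k (v ++ row w)) (Listₚ.map-∘ (graft a x x')) ⟩
      coeff k (scaleV (y * y') ((a , x) ◁ᵇ (a' , x')) ++ row w)
        ≈⟨ coeff-++ k (scaleV (y * y') ((a , x) ◁ᵇ (a' , x'))) (row w) ⟩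
      coeff k (scaleV (y * y') ((a , x) ◁ᵇ (a' , x'))) + coeff k (row w)
        ≈⟨ +-cong (coeff-scaleV k (y * y') ((a , x) ◁ᵇ (a' , x'))) (coeff-row w) ⟩
      (y * y') * coeff k ((a , x) ◁ᵇ (a' , x')) + y * weightedSum (λ q → coeff k ((a , x) ◁ᵇ q)) w
        ≈⟨ +-congʳ (*-assoc y y' _) ⟩
      y * (y' * coeff k ((a , x) ◁ᵇ (a' , x'))) + y * weightedSum (λ q → coeff k ((a , x) ◁ᵇ q)) w
        ≈⟨ distribˡ y _ _ ⟨
      y * (y' * coeff k ((a , x) ◁ᵇ (a' , x')) + weightedSum (λ q → coeff k ((a , x) ◁ᵇ q)) w) ∎

  coeff-◁ᵇ : ∀ k a x a' x' →
    coeff k ((a , x) ◁ᵇ (a' , x')) ≡ coeffᶜ k (map (map₂ (codeE a' ++_)) (graftᶜ a x x'))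
  coeff-◁ᵇ k a x a' x' =
    ≡.trans (coeff≡coeffᶜ k ((a , x) ◁ᵇ (a' , x'))) (cong (coeffᶜ k) (map-map-cong (λ _ → ≡.refl) (graft a x x')))

  coeff-◁ᵇ-respˡ : ∀ k p p' q → codeP p ≡ codeP p' → coeff k (p ◁ᵇ q) ≈ coeff k (p' ◁ᵇ q)
  coeff-◁ᵇ-respˡ k (a , x) (a₂ , x₂) (a' , x') p~p' with codeE-++-injective a a₂ (code x) (code x₂) p~p'
  ... | ≡.refl , x~x₂ = begin
    coeff k ((a , x) ◁ᵇ (a' , x'))                          ≡⟨ coeff-◁ᵇ k a x a' x' ⟩
    coeffᶜ k (map (map₂ (codeE a' ++_)) (graftᶜ a x x'))   ≡⟨ cong (coeffᶜ k ∘ map _) (graftᶜ-resp-code a x~x₂ x') ⟩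
    coeffᶜ k (map (map₂ (codeE a' ++_)) (graftᶜ a x₂ x'))  ≡⟨ coeff-◁ᵇ k a x₂ a' x' ⟨
    coeff k ((a , x₂) ◁ᵇ (a' , x'))                         ∎

  coeff-◁ᵇ-respʳ : ∀ k p q q' → codeP q ≡ codeP q' → coeff k (p ◁ᵇ q) ≈ coeff k (p ◁ᵇ q')
  coeff-◁ᵇ-respʳ k (a , x) (a' , x') (a₂ , x₂) q~q' with codeE-++-injective a' a₂ (code x') (code x₂) q~q'
  ... | ≡.refl , x'~x₂ = begin
    coeff k ((a , x) ◁ᵇ (a' , x'))
      ≡⟨ coeff-◁ᵇ k a x a' x' ⟩
    coeffᶜ k (map (map₂ (codeE a' ++_)) (graftᶜ a x x'))
      ≈⟨ coeffᶜ-resp-↭ k (↭ₚ.map⁺ _ (graftᶜ-resp-≅ a x (code-injective x' x₂ x'~x₂))) ⟩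
    coeffᶜ k (map (map₂ (codeE a' ++_)) (graftᶜ a x x₂))
      ≡⟨ coeff-◁ᵇ k a x a' x₂ ⟨
    coeff k ((a , x) ◁ᵇ (a' , x₂)) ∎

  ◁-cong : ∀ u u' w w' → u ≈V u' → w ≈V w' → (u ◁ w) ≈V (u' ◁ w')
  ◁-cong u u' w w' u≈u' w≈w' k = begin
    coeff k (u ◁ w)
      ≈⟨ coeff-◁ k u w ⟩
    weightedSum (λ p → weightedSum (λ q → coeff k (p ◁ᵇ q)) w) u
      ≈⟨ weightedSum-cong (λ p → weightedSum-resp-≈V _ (coeff-◁ᵇ-respʳ k p) w w' w≈w') u ⟩
    weightedSum (λ p → weightedSum (λ q → coeff k (p ◁ᵇ q)) w') u
      ≈⟨ weightedSum-resp-≈V _ (λ p p' p~p' → weightedSum-cong (λ q → coeff-◁ᵇ-respˡ k p p' q p~p') w')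
                             u u' u≈u' ⟩
    weightedSum (λ p → weightedSum (λ q → coeff k (p ◁ᵇ q)) w') u'
      ≈⟨ coeff-◁ k u' w' ⟨
    coeff k (u' ◁ w') ∎

module AdmissibleClosure {c ℓ : Level} (R : CommutativeRing c ℓ) (d : ℕ)
                         (lam : Vec (CommutativeRing.Carrier R) (suc d)) where
  open Construction R d lam
  open Coefficients R d lam
  open CommutativeRing R

  IsTuple : VB → Set
  IsTuple star   = ⊥
  IsTuple (nV _) = ⊤

  PhiAdmissible : EB → Carrier × (EB × VB) → Set
  PhiAdmissible a (_ , (e , v)) = (e ≡ xi → a ≡ xi) × IsTuple v

  phi-admissible : ∀ a v → All (PhiAdmissible a) (phi a v)
  phi-admissible (nE a) (nV b) = Allₚ.map⁺ (All.universal (λ _ → (λ ()) , tt) _)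
  phi-admissible (nE a) star   = []
  phi-admissible xi     (nV b) = ((λ _ → ≡.refl) , tt) ∷ []
  phi-admissible xi     star   = []

  graft-onto-star : ∀ a x → graft a x (node star []) ≡ []
  graft-onto-star xi     x = ≡.refl
  graft-onto-star (nE _) x = ≡.refl

  AdmT-star-root : ∀ {t} → AdmT t → root t ≡ star → t ≡ node star []
  AdmT-star-root (adm leaf _) ≡.refl = cong (node star) (leaf ≡.refl)

  child-admissible : ∀ {e t} → (e ≡ xi → root t ≡ star) × AdmT t → Admissible (e , t)
  child-admissible (e-star , t-adm) = (λ e≡xi → AdmT-star-root t-adm (e-star e≡xi)) , t-adm

  graft-AdmT : ∀ a x → Admissible (a , x) → ∀ t → AdmT t → All (AdmT ∘ proj₂) (graft a x t)
  graftCh-AdmCh : ∀ a x → Admissible (a , x) → ∀ cs → AdmCh cs → All (AdmCh ∘ proj₂) (graftCh a x cs)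

  graft-AdmT a x (a-xi , x-adm) (node v cs) (adm v-leaf cs-adm) = Allₚ.++⁺
    (Allₚ.map⁺ (All.map (λ {z} → grafted-at-root {z}) (phi-admissible a v)))
    (grafted-below v v-leaf)
    where
    grafted-at-root : ∀ {z} → PhiAdmissible a z →
                      AdmT (node (proj₂ (proj₂ z)) ((proj₁ (proj₂ z) , x) ∷ cs))
    grafted-at-root {_ , (e , nV b)} (e-xi , _) =
      adm (λ ()) (((λ e≡xi → cong root (a-xi (e-xi e≡xi))) , x-adm) ∷ cs-adm)
    grafted-below : ∀ v → (v ≡ star → cs ≡ []) →
      All (AdmT ∘ proj₂) (map (λ (k , cs') → (k , node v cs')) (graftCh a x cs))
    grafted-below star   leaf with leaf ≡.refl
    ... | ≡.refl = []
    grafted-below (nV b) _ = Allₚ.map⁺ (All.map (adm (λ ())) (graftCh-AdmCh a x (a-xi , x-adm) cs cs-adm))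

  graftCh-AdmCh a x x-adm []             [] = []
  graftCh-AdmCh a x x-adm ((xi , t) ∷ cs) ((t-star , t-adm) ∷ cs-adm)
    rewrite AdmT-star-root t-adm (t-star ≡.refl) | graft-onto-star a x =
    Allₚ.map⁺ (All.map (((λ _ → ≡.refl) , adm (λ _ → ≡.refl) []) ∷_)
                       (graftCh-AdmCh a x x-adm cs cs-adm))
  graftCh-AdmCh a x x-adm ((nE e , t) ∷ cs) ((t-star , t-adm) ∷ cs-adm) = Allₚ.++⁺
    (Allₚ.map⁺ (All.map (λ t'-adm → ((λ ()) , t'-adm) ∷ cs-adm) (graft-AdmT a x x-adm t t-adm)))
    (Allₚ.map⁺ (All.map ((t-star , t-adm) ∷_) (graftCh-AdmCh a x x-adm cs cs-adm)))

  AllAdmissible : Vect → Set c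
  AllAdmissible = All (Admissible ∘ proj₂)

  ◁-admissible : ∀ u w → AllAdmissible u → AllAdmissible w → AllAdmissible (u ◁ w)
  ◁-admissible []                  w _                 _     = []
  ◁-admissible ((y , (a , x)) ∷ u) w (x-adm ∷ u-adm) w-adm =
    Allₚ.++⁺ (row w w-adm) (◁-admissible u w u-adm w-adm)
    where
    row : ∀ w → AllAdmissible w → AllAdmissible
      (concatMap (λ (y' , (a' , x')) → map (λ (κ , t) → (y * y' * κ , (a' , t))) (graft a x x')) w)
    row []                      []                           = []
    row ((y' , (xi , x')) ∷ w)   ((x'-star , _) ∷ w-adm)
      rewrite x'-star ≡.refl | graft-onto-star a x = row w w-adm
    row ((y' , (nE a' , x')) ∷ w) ((_ , x'-adm) ∷ w-adm) = Allₚ.++⁺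
      (Allₚ.map⁺ (All.map ((λ ()) ,_) (graft-AdmT a x x-adm x' x'-adm)))
      (row w w-adm)

  generator-admissible : ∀ {p} → Generator p → Admissible p
  generator-admissible gXi         = (λ _ → ≡.refl) , adm (λ _ → ≡.refl) []
  generator-admissible (gStar a)   = (λ ()) , adm (λ _ → ≡.refl) []
  generator-admissible (gVert a b) = (λ ()) , adm (λ ()) []

  InG⇒InSpan : ∀ {v} → InG v → InSpan v
  InG⇒InSpan (gen {p} g) = (1# , p) ∷ [] , generator-admissible g ∷ [] , ≈V-refl ((1# , p) ∷ [])
  InG⇒InSpan zeroG = [] , [] , ≈V-refl []
  InG⇒InSpan (addG {u} {w} u∈g w∈g) with InG⇒InSpan u∈g | InG⇒InSpan w∈g
  ... | L , L-adm , u≈L | M , M-adm , w≈M = L ++ M , Allₚ.++⁺ L-adm M-adm , ++-cong-≈V u L w M u≈L w≈M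
  InG⇒InSpan (scalG {u} x u∈g) with InG⇒InSpan u∈g
  ... | L , L-adm , u≈L = scaleV x L , Allₚ.map⁺ L-adm , scaleV-cong-≈V x u L u≈L
  InG⇒InSpan (prodG {u} {w} u∈g w∈g) with InG⇒InSpan u∈g | InG⇒InSpan w∈g
  ... | L , L-adm , u≈L | M , M-adm , w≈M =
    L ◁ M , ◁-admissible L M L-adm M-adm , ◁-cong u L w M u≈L w≈M
  InG⇒InSpan (respG {u} {w} u≈w u∈g) with InG⇒InSpan u∈g
  ... | L , L-adm , u≈L = L , L-adm , ≈V-trans w u L (≈V-sym u w u≈w) u≈L

module Tuples (d : ℕ) where
  open Decorations d

  0ᵗ : ∀ {n} → Vec ℕ n
  0ᵗ {n} = Vec.replicate n 0

  sum-∸-≤ : ∀ {n} (x l : Vec ℕ n) → Vec.sum (x -t l) ≤ Vec.sum x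
  sum-∸-≤ []      []      = z≤n
  sum-∸-≤ (x ∷ xs) (l ∷ ls) = ℕₚ.+-mono-≤ (ℕₚ.m∸n≤m x l) (sum-∸-≤ xs ls)

  sum-∸-< : ∀ {n} (x l : Vec ℕ n) → Pointwise _≤_ l x → Any (0 <_) l → Vec.sum (x -t l) < Vec.sum x
  sum-∸-< (x ∷ xs) (l ∷ ls) (l≤x ∷ _) (here 0<l) =
    ℕₚ.+-mono-<-≤ (ℕₚ.∸-monoʳ-< {x} {l} {0} 0<l l≤x) (sum-∸-≤ xs ls)
  sum-∸-< (x ∷ xs) (l ∷ ls) (_ ∷ ls≤xs) (there ls≢0) =
    ℕₚ.+-mono-≤-< (ℕₚ.m∸n≤m x l) (sum-∸-< xs ls ls≤xs ls≢0)

  ∸-0ᵗ : ∀ {n} (x : Vec ℕ n) → x -t 0ᵗ ≡ x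
  ∸-0ᵗ []       = ≡.refl
  ∸-0ᵗ (x ∷ xs) = cong (x ∷_) (∸-0ᵗ xs)

  0ᵗ-≤?t : ∀ {n} (b : Vec ℕ n) → (0ᵗ ≤?t b) ≡ true
  0ᵗ-≤?t []      = ≡.refl
  0ᵗ-≤?t (x ∷ b) = 0ᵗ-≤?t b

  binomT-0ᵗ : ∀ {n} (b : Vec ℕ n) → binomT b 0ᵗ ≡ 1
  binomT-0ᵗ []      = ≡.refl
  binomT-0ᵗ (x ∷ b) = ≡.trans (ℕₚ.+-identityʳ _) (binomT-0ᵗ b)

  below-≤ : ∀ {n} (c : Vec ℕ n) → All (λ l → Pointwise _≤_ l c) (below c)
  below-≤ []       = [] ∷ []
  below-≤ (a ∷ as) = Allₚ.concat⁺ (Allₚ.map⁺ (Allₚ.applyUpTo⁺₁ _ (suc a)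
    (λ i<1+a → Allₚ.map⁺ (All.map (ℕₚ.≤-pred i<1+a ∷_) (below-≤ as)))))

  below-0ᵗ-∷ : ∀ {n} (c : Vec ℕ n) →
    ∃ λ B → below c ≡ 0ᵗ ∷ B × All (λ l → Pointwise _≤_ l c × Any (0 <_) l) B
  below-0ᵗ-∷ []       = [] , ≡.refl , []
  below-0ᵗ-∷ (a ∷ as) with below-0ᵗ-∷ as
  ... | B , below≡ , B-ok =
    _ , cong (λ L → map (0 ∷_) L ++ concatMap (λ i → map (i ∷_) (below as)) (applyUpTo suc a)) below≡ ,
    Allₚ.++⁺ (Allₚ.map⁺ (All.map (λ (l≤ , l≢0) → (z≤n ∷ l≤) , there l≢0) B-ok))
             (Allₚ.concat⁺ (Allₚ.map⁺ (Allₚ.applyUpTo⁺₁ suc a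
                (λ j<a → Allₚ.map⁺ (All.map (λ l≤ → (j<a ∷ l≤) , here (s≤s z≤n)) (below-≤ as))))))

module TreeMeasures (d : ℕ) where
  open Decorations d
  open import Data.Nat using (_+_)

  weightE : EB → ℕ
  weightE xi     = 0
  weightE (nE a) = Vec.sum a

  weightV : VB → ℕ
  weightV star   = 0
  weightV (nV b) = Vec.sum b

  weight : Tree → ℕ
  weightCh : List (EB × Tree) → ℕ
  weight (node v cs) = weightV v + weightCh cs
  weightCh []             = 0
  weightCh ((e , t) ∷ cs) = weightE e + weight t + weightCh cs

  size : Tree → ℕ
  sizeCh : List (EB × Tree) → ℕ
  size (node v cs) = suc (sizeCh cs)
  sizeCh []             = 0
  sizeCh ((e , t) ∷ cs) = size t + sizeCh cs

  rank : Tree → ℕ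
  rank (node v cs) = weight (node v cs) + length cs

module Generation {c ℓ : Level} (R : CommutativeRing c ℓ) (d : ℕ)
                  (lam : Vec (CommutativeRing.Carrier R) (suc d)) where
  open Construction R d lam
  open Coefficients R d lam
  open AdmissibleClosure R d lam
  open Tuples d
  open TreeMeasures d
  open CommutativeRing R hiding (_+_)
  open import Data.Nat using (_+_)

  ℕ-exchange : ∀ x y z → x + (y + z) ≡ y + (x + z)
  ℕ-exchange = CommutativeSemigroupProperties.x∙yz≈y∙xz ℕₚ.+-commutativeSemigroup

  powers-0ᵗ : ∀ {n} (xs : Vec Carrier n) → Vec.foldr _ _*_ 1# (Vec.zipWith pow xs 0ᵗ) ≈ 1#
  powers-0ᵗ []       = refl
  powers-0ᵗ (x ∷ xs) = trans (*-identityˡ _) (powers-0ᵗ xs)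

  phi-weight-≤ : ∀ a v →
    All (λ (_ , (e' , v')) → weightE e' + weightV v' ≤ weightE a + weightV v) (phi a v)
  phi-weight-≤ (nE a) (nV b) =
    Allₚ.map⁺ (All.universal (λ l → ℕₚ.+-mono-≤ (sum-∸-≤ a l) (sum-∸-≤ b l)) _)
  phi-weight-≤ (nE a) star   = []
  phi-weight-≤ xi     (nV b) = ℕₚ.≤-refl ∷ []
  phi-weight-≤ xi     star   = []

  phi-leading : ∀ e b → Σ Carrier λ κ → Σ (List (Carrier × (EB × VB))) λ rest →
    phi e (nV b) ≡ (κ , (e , nV b)) ∷ rest × κ ≈ 1# ×
    All (λ (_ , (e' , v')) → weightE e' + weightV v' < weightE e + Vec.sum b) rest
  phi-leading xi     b = 1# , [] , ≡.refl , refl , []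
  phi-leading (nE a) b = filtered _ (0ᵗ-≤?t b)
    where
    term : Tup → Carrier × (EB × VB)
    term l = (lamPow l * ℕ→K R (binomT b l) , (nE (a -t l) , nV (b -t l)))
    -- The decision procedure filtering below a in phi is local to its definition, hence abstracted.
    filtered : ∀ {Q : Tup → Set} (Q? : Decidable Q) → Q 0ᵗ →
      Σ Carrier λ κ → Σ (List (Carrier × (EB × VB))) λ rest →
      map term (filter Q? (below a)) ≡ (κ , (nE a , nV b)) ∷ rest × κ ≈ 1# ×
      All (λ (_ , (e' , v')) → weightE e' + weightV v' < Vec.sum a + Vec.sum b) rest
    filtered Q? Q0 with below-0ᵗ-∷ a
    ... | B , below≡ , B-ok =
      proj₁ (term 0ᵗ) , map term (filter Q? B) ,
      ≡.trans (cong (map term ∘ filter Q?) below≡)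
        (≡.trans (cong (map term) (Listₚ.filter-accept Q? Q0))
          (cong (λ (a' , b') → (proj₁ (term 0ᵗ) , (nE a' , nV b')) ∷ map term (filter Q? B))
                (cong₂ _,_ (∸-0ᵗ a) (∸-0ᵗ b)))) ,
      trans (*-cong (powers-0ᵗ lam) (reflexive (cong (ℕ→K R) (binomT-0ᵗ b))))
            (trans (*-identityˡ _) (+-identityʳ 1#)) ,
      Allₚ.map⁺ (All.map (λ {l} (l≤a , l≢0) → ℕₚ.+-mono-<-≤ (sum-∸-< a l l≤a l≢0) (sum-∸-≤ b l))
                          (Allₚ.filter⁺ Q? B-ok))

  graft-size : ∀ a x t → All (λ (_ , t') → size t' ≡ size x + size t) (graft a x t)
  graftCh-size : ∀ a x cs → All (λ (_ , cs') → sizeCh cs' ≡ size x + sizeCh cs) (graftCh a x cs)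
  graft-size a x (node v cs) = Allₚ.++⁺
    (Allₚ.map⁺ (All.universal (λ _ → ≡.sym (ℕₚ.+-suc (size x) (sizeCh cs))) (phi a v)))
    (Allₚ.map⁺ (All.map (λ eq → ≡.trans (cong suc eq) (≡.sym (ℕₚ.+-suc (size x) (sizeCh cs))))
                        (graftCh-size a x cs)))
  graftCh-size a x []             = []
  graftCh-size a x ((e , t) ∷ cs) = Allₚ.++⁺
    (Allₚ.map⁺ (All.map (λ eq → ≡.trans (cong (_+ sizeCh cs) eq) (ℕₚ.+-assoc (size x) (size t) (sizeCh cs)))
                        (graft-size a x t)))
    (Allₚ.map⁺ (All.map (λ eq → ≡.trans (cong (size t +_) eq) (ℕ-exchange (size t) (size x) (sizeCh cs)))
                        (graftCh-size a x cs)))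

  graftCh-length : ∀ a x cs → All (λ (_ , cs') → length cs' ≡ length cs) (graftCh a x cs)
  graftCh-length a x []             = []
  graftCh-length a x ((e , t) ∷ cs) = Allₚ.++⁺
    (Allₚ.map⁺ (All.universal (λ _ → ≡.refl) (graft a x t)))
    (Allₚ.map⁺ (All.map (cong suc) (graftCh-length a x cs)))

  weight-grafted-at-root : ∀ v' e' x cs →
    weight (node v' ((e' , x) ∷ cs)) ≡ weightE e' + weightV v' + weight x + weightCh cs
  weight-grafted-at-root v' e' x cs = rearrange (weightV v') (weightE e') (weight x) (weightCh cs)
    where
    rearrange : ∀ v e x r → v + (e + x + r) ≡ e + v + x + r
    rearrange = solve-∀

  graft-weight : ∀ a x t → All (λ (_ , t') → weight t' ≤ weightE a + weight x + weight t) (graft a x t)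
  graftCh-weight : ∀ a x cs →
    All (λ (_ , cs') → weightCh cs' ≤ weightE a + weight x + weightCh cs) (graftCh a x cs)

  graft-weight a x (node v cs) = Allₚ.++⁺
    (Allₚ.map⁺ (All.map (λ {z} → at-root z) (phi-weight-≤ a v)))
    (Allₚ.map⁺ (All.map (λ {z} → in-children z) (graftCh-weight a x cs)))
    where
    open ℕₚ.≤-Reasoning
    at-root : ∀ z → weightE (proj₁ (proj₂ z)) + weightV (proj₂ (proj₂ z)) ≤ weightE a + weightV v →
      weight (node (proj₂ (proj₂ z)) ((proj₁ (proj₂ z) , x) ∷ cs)) ≤ weightE a + weight x + weight (node v cs)
    at-root (_ , (e' , v')) lighter = begin
      weight (node v' ((e' , x) ∷ cs))                ≡⟨ weight-grafted-at-root v' e' x cs ⟩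
      weightE e' + weightV v' + weight x + weightCh cs ≤⟨ ℕₚ.+-monoˡ-≤ _ (ℕₚ.+-monoˡ-≤ _ lighter) ⟩
      weightE a + weightV v + weight x + weightCh cs   ≡⟨ rearrange (weightE a) (weightV v) (weight x) (weightCh cs) ⟩
      weightE a + weight x + (weightV v + weightCh cs) ∎
      where
      rearrange : ∀ a v x r → a + v + x + r ≡ a + x + (v + r)
      rearrange = solve-∀
    in-children : ∀ z → weightCh (proj₂ z) ≤ weightE a + weight x + weightCh cs →
      weightV v + weightCh (proj₂ z) ≤ weightE a + weight x + (weightV v + weightCh cs)
    in-children (_ , cs') lighter = begin
      weightV v + weightCh cs'                         ≤⟨ ℕₚ.+-monoʳ-≤ (weightV v) lighter ⟩
      weightV v + (weightE a + weight x + weightCh cs)  ≡⟨ ℕ-exchange (weightV v) _ (weightCh cs) ⟩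
      weightE a + weight x + (weightV v + weightCh cs) ∎

  graftCh-weight a x []             = []
  graftCh-weight a x ((e , t) ∷ cs) = Allₚ.++⁺
    (Allₚ.map⁺ (All.map (λ {z} → in-head z) (graft-weight a x t)))
    (Allₚ.map⁺ (All.map (λ {z} → in-tail z) (graftCh-weight a x cs)))
    where
    open ℕₚ.≤-Reasoning
    A = weightE a + weight x
    in-head : ∀ z → weight (proj₂ z) ≤ A + weight t →
      weightE e + weight (proj₂ z) + weightCh cs ≤ A + (weightE e + weight t + weightCh cs)
    in-head (_ , t') lighter = begin
      weightE e + weight t' + weightCh cs        ≤⟨ ℕₚ.+-monoˡ-≤ _ (ℕₚ.+-monoʳ-≤ (weightE e) lighter) ⟩
      weightE e + (A + weight t) + weightCh cs   ≡⟨ rearrange (weightE e) A (weight t) (weightCh cs) ⟩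
      A + (weightE e + weight t + weightCh cs)   ∎
      where
      rearrange : ∀ e A t r → e + (A + t) + r ≡ A + (e + t + r)
      rearrange = solve-∀
    in-tail : ∀ z → weightCh (proj₂ z) ≤ A + weightCh cs →
      weightE e + weight t + weightCh (proj₂ z) ≤ A + (weightE e + weight t + weightCh cs)
    in-tail (_ , cs') lighter = begin
      weightE e + weight t + weightCh cs'         ≤⟨ ℕₚ.+-monoʳ-≤ (weightE e + weight t) lighter ⟩
      weightE e + weight t + (A + weightCh cs)    ≡⟨ ℕ-exchange (weightE e + weight t) A (weightCh cs) ⟩
      A + (weightE e + weight t + weightCh cs)    ∎

  Smaller : Tree → Carrier × Tree → Set
  Smaller T (_ , t) = (AdmT t × size t ≡ size T) × rank t < rank T

  graft-leading : ∀ e₁ S₁ b rest → Admissible (e₁ , S₁) → AdmCh rest →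
    let T = node (nV b) ((e₁ , S₁) ∷ rest) in
    Σ Carrier λ κ → Σ (List (Carrier × Tree)) λ lower →
    graft e₁ S₁ (node (nV b) rest) ≡ (κ , T) ∷ lower × κ ≈ 1# × All (Smaller T) lower
  graft-leading e₁ S₁ b rest S₁-adm rest-adm with phi-leading e₁ b
  ... | κ , PL , phi≡ , κ≈1 , PL-lighter =
    κ , lower , graft≡ , κ≈1 ,
    All.zip (adm-and-size , Allₚ.++⁺
      (Allₚ.map⁺ (All.map (λ {z} → at-root z) PL-lighter))
      (Allₚ.map⁺ (All.map (λ {z} → in-children z)
                          (All.zip (graftCh-weight e₁ S₁ rest , graftCh-length e₁ S₁ rest)))))
    where
    T = node (nV b) ((e₁ , S₁) ∷ rest)
    rootTree : Carrier × (EB × VB) → Carrier × Tree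
    rootTree (k , (e' , v')) = k , node v' ((e' , S₁) ∷ rest)
    childTree : Carrier × List (EB × Tree) → Carrier × Tree
    childTree (k , cs') = k , node (nV b) cs'
    lower = map rootTree PL ++ map childTree (graftCh e₁ S₁ rest)

    graft≡ : graft e₁ S₁ (node (nV b) rest) ≡ (κ , T) ∷ lower
    graft≡ = cong (λ L → map rootTree L ++ map childTree (graftCh e₁ S₁ rest)) phi≡

    adm-and-size : All (λ (_ , t) → AdmT t × size t ≡ size T) lower
    adm-and-size = All.tail (≡.subst (All (λ (_ , t) → AdmT t × size t ≡ size T)) graft≡
      (All.zip (graft-AdmT e₁ S₁ S₁-adm _ (adm (λ ()) rest-adm) ,
                All.map (λ eq → ≡.trans eq (ℕₚ.+-suc (size S₁) (sizeCh rest))) (graft-size e₁ S₁ _))))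

    open ℕₚ.≤-Reasoning
    at-root : ∀ z → weightE (proj₁ (proj₂ z)) + weightV (proj₂ (proj₂ z)) < weightE e₁ + Vec.sum b →
      rank (proj₂ (rootTree z)) < rank T
    at-root (_ , (e' , v')) lighter = ℕₚ.+-monoˡ-< (suc (length rest)) (begin-strict
      weight (node v' ((e' , S₁) ∷ rest))               ≡⟨ weight-grafted-at-root v' e' S₁ rest ⟩
      weightE e' + weightV v' + weight S₁ + weightCh rest <⟨ ℕₚ.+-monoˡ-< _ (ℕₚ.+-monoˡ-< _ lighter) ⟩
      weightE e₁ + Vec.sum b + weight S₁ + weightCh rest  ≡⟨ weight-grafted-at-root (nV b) e₁ S₁ rest ⟨
      weight T                                           ∎)
    in-children : ∀ z → weightCh (proj₂ z) ≤ weightE e₁ + weight S₁ + weightCh rest × length (proj₂ z) ≡ length rest →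
      rank (proj₂ (childTree z)) < rank T
    in-children (_ , cs') (lighter , same-length) = begin-strict
      Vec.sum b + weightCh cs' + length cs'   ≤⟨ ℕₚ.+-mono-≤ (ℕₚ.+-monoʳ-≤ (Vec.sum b) lighter) (ℕₚ.≤-reflexive same-length) ⟩
      weight T + length rest                  <⟨ ℕₚ.+-monoʳ-< (weight T) (ℕₚ.n<1+n (length rest)) ⟩
      rank T                                  ∎

  InG-basis-combination : ∀ L → All (λ (_ , p) → InG ((1# , p) ∷ [])) L → InG L
  InG-basis-combination []            []          = zeroG
  InG-basis-combination ((κ , p) ∷ L) (p∈g ∷ L∈g) =
    addG {(κ , p) ∷ []} (respG κ*1≈κ (scalG κ p∈g)) (InG-basis-combination L L∈g)
    where
    κ*1≈κ : ((κ * 1# , p) ∷ []) ≈V ((κ , p) ∷ [])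
    κ*1≈κ k with codeP p ≟ᶜ k
    ... | yes _ = +-congʳ (*-identityʳ κ)
    ... | no  _ = refl

  InG-leading-term : ∀ {κ p} L → κ ≈ 1# → InG ((κ , p) ∷ L) → InG L → InG ((1# , p) ∷ [])
  InG-leading-term {κ} {p} L κ≈1 κp+L∈g L∈g = respG p≈κp+L-L (addG κp+L∈g (scalG (- 1#) L∈g))
    where
    L-L≈0 : ∀ k → coeff k (L ++ scaleV (- 1#) L) ≈ 0#
    L-L≈0 k = trans (coeff-++-scaleV-neg k L L) (-‿inverseʳ _)
    p≈κp+L-L : (((κ , p) ∷ L) ++ scaleV (- 1#) L) ≈V ((1# , p) ∷ [])
    p≈κp+L-L k with codeP p ≟ᶜ k
    ... | yes _ = +-cong κ≈1 (L-L≈0 k)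
    ... | no  _ = L-L≈0 k

  ◁-singletons : ∀ y a x y' a' x' → ((y , (a , x)) ∷ []) ◁ ((y' , (a' , x')) ∷ []) ≡
    map (λ (κ , t) → (y * y' * κ , (a' , t))) (graft a x x')
  ◁-singletons y a x y' a' x' = ≡.trans (Listₚ.++-identityʳ _) (Listₚ.++-identityʳ _)

  _⊏_ : PT → PT → Set
  _⊏_ = ×-Lex _≡_ _<_ _<_ on λ (_ , t) → size t , rank t

  ⊏-wellFounded : WellFounded _⊏_
  ⊏-wellFounded = On.wellFounded _ (×-wellFounded <-wellFounded <-wellFounded)

  size-positive : ∀ t → 1 ≤ size t
  size-positive (node _ _) = s≤s z≤n

  InG-grafted : ∀ a b e₁ S₁ rest → let T = (nE a , node (nV b) ((e₁ , S₁) ∷ rest)) in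
    Admissible T → (∀ {q} → q ⊏ T → Admissible q → InG ((1# , q) ∷ [])) → InG ((1# , T) ∷ [])
  InG-grafted a b e₁ S₁ rest (_ , adm _ (S₁-adm ∷ rest-adm)) ih
    with graft-leading e₁ S₁ b rest (child-admissible S₁-adm) rest-adm
  ... | κ , lower , graft≡ , κ≈1 , lower-smaller =
    InG-leading-term (map plant lower) (trans (*-congʳ (*-identityˡ 1#)) (trans (*-identityˡ κ) κ≈1))
      (≡.subst InG (≡.trans (◁-singletons 1# e₁ S₁ 1# (nE a) (node (nV b) rest)) (cong (map plant) graft≡))
         (prodG (ih S₁⊏T (child-admissible S₁-adm)) (ih rest⊏T ((λ ()) , adm (λ ()) rest-adm))))
      (InG-basis-combination (map plant lower)
         (Allₚ.map⁺ (All.map (λ ((t-adm , same-size) , smaller-rank) →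
                                ih (inj₂ (same-size , smaller-rank)) ((λ ()) , t-adm))
                             lower-smaller)))
    where
    plant : Carrier × Tree → Carrier × PT
    plant (k , t) = 1# * 1# * k , (nE a , t)
    S₁⊏T : (e₁ , S₁) ⊏ (nE a , node (nV b) ((e₁ , S₁) ∷ rest))
    S₁⊏T = inj₁ (s≤s (ℕₚ.m≤m+n (size S₁) (sizeCh rest)))
    rest⊏T : (nE a , node (nV b) rest) ⊏ (nE a , node (nV b) ((e₁ , S₁) ∷ rest))
    rest⊏T = inj₁ (s≤s (ℕₚ.+-monoˡ-≤ (sizeCh rest) (size-positive S₁)))

  admissible⇒InG : ∀ p → Admissible p → InG ((1# , p) ∷ [])
  admissible⇒InG = WF.All.wfRec ⊏-wellFounded _ (λ p → Admissible p → InG ((1# , p) ∷ [])) step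
    where
    step : ∀ p → (∀ {q} → q ⊏ p → Admissible q → InG ((1# , q) ∷ [])) →
           Admissible p → InG ((1# , p) ∷ [])
    step (xi , node star [])        _ _ = gen gXi
    step (xi , node (nV _) _)       _ (xi-leaf , _) with () ← xi-leaf ≡.refl
    step (xi , node star (_ ∷ _))   _ (xi-leaf , _) with () ← xi-leaf ≡.refl
    step (nE a , node star [])      _ _ = gen (gStar a)
    step (nE a , node star (_ ∷ _)) _ (_ , adm star-leaf _) with () ← star-leaf ≡.refl
    step (nE a , node (nV b) [])    _ _ = gen (gVert a b)
    step (nE a , node (nV b) ((e₁ , S₁) ∷ rest)) ih T-adm = InG-grafted a b e₁ S₁ rest T-adm ih

  InSpan⇒InG : ∀ {v} → InSpan v → InG v
  InSpan⇒InG {v} (L , L-adm , v≈L) =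
    respG (≈V-sym v L v≈L) (InG-basis-combination L (All.map (λ {(_ , p)} → admissible⇒InG p) L-adm))

proposition4p10 : {c ℓ : Level} (R : CommutativeRing c ℓ) → IsField R → CharZero R →
    (d : ℕ) (lam : Vec (CommutativeRing.Carrier R) (suc d)) →
    let open Construction R d lam in
    ∀ (v : Vect) → InG v ⇔ InSpan v
proposition4p10 R _ _ d lam v =
  mk⇔ (AdmissibleClosure.InG⇒InSpan R d lam) (Generation.InSpan⇒InG R d lam)
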